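{- Let $\mathcal F$ be a group pair, and suppose the set $A$ of frame relations contains the identity relation $\mathrm{id}_U$ on $U=\bigcup_{x\in I}G_x$. Then for any $(x,y),(y,z)\in\mathcal E$ the following are equivalent: (i) $R_{xy,\alpha}\,;\,R_{yz,\beta}\in A$ for some $\alpha<\kappa_{xy}$ and some $\beta<\kappa_{yz}$; (ii) $R_{xy,\alpha}\,;\,R_{yz,\beta}\in A$ for all $\alpha<\kappa_{xy}$ and all $\beta<\kappa_{yz}$.
   Context: A group pair consists of the following data. - Pairwise disjoint groups $G_x$ ($x\in I$). - An equivalence relation $\mathcal E$ on $I$. - For each $(x,y)\in\mathcal E$, an isomorphism $\varphi_{xy}:G_x/H_{xy}\to G_y/K_{xy}$, where $H_{xy}\trianglelefteq G_x$ and $K_{xy}\trianglelefteq G_y$. For each $(x,y)\in\mathcal E$ fix an enumeration without repetitions $\langle H_{xy,\gamma}:\gamma<\kappa_{xy}\rangle$ of the cosets of $H_{xy}$, with $H_{xy,0}=H_{xy}$, and put $K_{xy,\gamma}=\varphi_{xy}(H_{xy,\gamma})$. Let $R_{xy,\alpha}=\bigcup_\gamma H_{xy,\gamma}\times(K_{xy,\gamma}\circ K_{xy,\alpha})$, where $\circ$ is the complex product. The set $A$ of frame relations is the set of all unions of subfamilies of these relations. $;$ is relational composition. -}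

module Defs where

open import Level using (Level; _⊔_) renaming (suc to lsuc)
open import Algebra.Bundles using (Group)
open import Data.Product using (Σ; ∃; _×_; _,_; Σ-syntax; ∃-syntax)
open import Function.Bundles using (_⇔_)
open import Relation.Binary.Structures using (IsEquivalence)
open import Relation.Binary.PropositionalEquality using (_≡_; subst)

module _ {a : Level} (G : Group a a) where
  open Group G

  record NormalSubgroup : Set (lsuc a) where
    field
      mem      : Carrier → Set a
      mem-resp : ∀ {u v} → u ≈ v → mem u → mem v
      ε∈       : mem ε
      ∙∈       : ∀ {u v} → mem u → mem v → mem (u ∙ v)
      ⁻¹∈      : ∀ {u} → mem u → mem (u ⁻¹)
      normal   : ∀ g {n} → mem n → mem ((g ∙ n) ∙ g ⁻¹)

  coset : NormalSubgroup → Carrier → Carrier → Set a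
  coset N g u = NormalSubgroup.mem N (g ⁻¹ ∙ u)

  _⊙_ : (Carrier → Set a) → (Carrier → Set a) → Carrier → Set a
  (S ⊙ T) u = Σ[ c ∈ Carrier ] Σ[ d ∈ Carrier ] (S c × T d × u ≈ c ∙ d)

  -- an enumeration without repetitions ⟨ N_γ : γ < κ ⟩ of the cosets of N,
  -- with N_0 = N  (N_γ = rep γ · N)
  record CosetEnumeration (N : NormalSubgroup) (κ : Set a) : Set a where
    field
      rep      : κ → Carrier
      zero     : κ
      rep-zero : NormalSubgroup.mem N (rep zero)
      covers   : ∀ u → ∃[ γ ] coset N (rep γ) u
      no-rep   : ∀ γ δ → coset N (rep γ) (rep δ) → γ ≡ δ

-- An isomorphism  G/H → G'/K , given on representatives

record QuotientIso {a : Level} {G G' : Group a a}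
                   (H : NormalSubgroup G) (K : NormalSubgroup G') : Set a where
  private
    module G  = Group G
    module G' = Group G'
  _~H_ : G.Carrier → G.Carrier → Set a
  u ~H v = coset G H u v
  _~K_ : G'.Carrier → G'.Carrier → Set a
  u ~K v = coset G' K u v
  field
    f        : G.Carrier → G'.Carrier
    f-wd     : ∀ {u v} → u ~H v → f u ~K f v
    f-inj    : ∀ {u v} → f u ~K f v → u ~H v
    f-hom    : ∀ u v → f (u G.∙ v) ~K (f u G'.∙ f v)
    f-surj   : ∀ w → ∃[ u ] f u ~K w

record GroupPair (a : Level) : Set (lsuc a) where
  field
    I       : Set a
    G       : I → Group a a
    E       : I → I → Set a
    E-equiv : IsEquivalence E
    E-prop  : ∀ {x y} (p q : E x y) → p ≡ q
    H       : ∀ {x y} → E x y → NormalSubgroup (G x)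
    K       : ∀ {x y} → E x y → NormalSubgroup (G y)
    φ       : ∀ {x y} (e : E x y) → QuotientIso (H e) (K e)
    κ       : ∀ {x y} → E x y → Set a
    enum    : ∀ {x y} (e : E x y) → CosetEnumeration (G x) (H e) (κ e)

  Car : I → Set a
  Car i = Group.Carrier (G i)

  U : Set a
  U = Σ I Car

  Rel : Set (lsuc a)
  Rel = U → U → Set a

  Hc : ∀ {x y} (e : E x y) → κ e → Car x → Set a
  Hc {x} e γ = coset (G x) (H e) (CosetEnumeration.rep (enum e) γ)

  Kc : ∀ {x y} (e : E x y) → κ e → Car y → Set a
  Kc {x} {y} e γ =
    coset (G y) (K e) (QuotientIso.f (φ e) (CosetEnumeration.rep (enum e) γ))

  -- R_{xy,α} = ⋃_γ H_{xy,γ} × (K_{xy,γ} ∘ K_{xy,α})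
  R : ∀ {x y} (e : E x y) → κ e → Rel
  R {x} {y} e α (x' , u) (y' , v) =
    Σ[ p ∈ x' ≡ x ] Σ[ q ∈ y' ≡ y ] ∃[ γ ]
      (Hc e γ (subst Car p u) × _⊙_ (G y) (Kc e γ) (Kc e α) (subst Car q v))

  idU : Rel
  idU (x , u) (y , v) = Σ[ p ∈ x ≡ y ] Group._≈_ (G y) (subst Car p u) v

  _⨾_ : Rel → Rel → Rel
  (S ⨾ T) u w = Σ[ v ∈ U ] (S u v × T v w)

  _≐_ : Rel → Rel → Set a
  S ≐ T = ∀ u w → S u w ⇔ T u w

  -- S ∈ A : S is the union of a subfamily of the R_{xy,α}
  InA : Rel → Set (lsuc a)
  InA S = Σ[ P ∈ (∀ x y (e : E x y) → κ e → Set a) ]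
    (S ≐ λ u w → Σ[ x ∈ I ] Σ[ y ∈ I ] Σ[ e ∈ E x y ] Σ[ α ∈ κ e ]
                   (P x y e α × R e α u w))

module Submission where

-- Write ρ_δ for a representative of K_{xy,δ}.  Then R_{xy,δ} relates
-- u ∈ G_x to v ∈ G_y exactly when φ(u)·ρ_δ ≡ v modulo K_{xy}, so
-- right-translating the target coordinate of R_{xy,δ} by t ∈ G_y yields
-- another relation R_{xy,δ'} (the cosets K_{xy,δ} exhaust G_y/K_{xy}).
-- Consequently A is closed under right translation of targets in a fixed G_z.
-- On the other hand, R_{xy,α'} ; R_{yz,β'} is the right translate of
-- R_{xy,α} ; R_{yz,β} by an explicit element s ∈ G_z.  Hence (i) implies (ii);
-- (ii) implies (i) by taking α = β = 0.

open import Defs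
open import Level using (Level)
open import Data.Product using (Σ-syntax; _,_; _×_; ∃-syntax)
open import Function.Base using (_∘_)
open import Function.Bundles using (_⇔_; mk⇔; Equivalence)
import Function.Properties.Equivalence as ⇔
open import Relation.Binary.PropositionalEquality using (_≡_; refl; subst)
open import Relation.Binary.Bundles using (Setoid)
open import Algebra.Bundles using (Group)
import Algebra.Properties.Group as GroupProperties
import Relation.Binary.Reasoning.Setoid as SetoidReasoning

open Equivalence using (to; from)

module Rearrangement {a : Level} (G : Group a a) where
  open Group G
  open GroupProperties G using (\\-leftDividesˡ)
  open SetoidReasoning setoid

  insert-inverse : ∀ x b z → x ∙ z ≈ (x ∙ b) ∙ (b ⁻¹ ∙ z)
  insert-inverse x b z = begin
    x ∙ z                  ≈⟨ ∙-congˡ (\\-leftDividesˡ b z) ⟨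
    x ∙ (b ∙ (b ⁻¹ ∙ z))   ≈⟨ assoc x b (b ⁻¹ ∙ z) ⟨
    (x ∙ b) ∙ (b ⁻¹ ∙ z)   ∎

  cancel-middle : ∀ p q b r → (p ∙ (q ∙ b)) ∙ (b ⁻¹ ∙ r) ≈ p ∙ (q ∙ r)
  cancel-middle p q b r = begin
    (p ∙ (q ∙ b)) ∙ (b ⁻¹ ∙ r)  ≈⟨ assoc p (q ∙ b) (b ⁻¹ ∙ r) ⟩
    p ∙ ((q ∙ b) ∙ (b ⁻¹ ∙ r))  ≈⟨ ∙-congˡ (insert-inverse q b r) ⟨
    p ∙ (q ∙ r)                 ∎

module Congruence {a : Level} (G : Group a a) (N : NormalSubgroup G) where
  open Group G renaming (refl to ≈-refl)
  open NormalSubgroup N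
  open GroupProperties G
    using (⁻¹-involutive; ⁻¹-anti-homo-∙; \\-leftDividesˡ; \\-leftDividesʳ; //-rightDividesʳ)

  infix 4 _~_
  _~_ : Carrier → Carrier → Set a
  g ~ h = coset G N g h

  ~-reflexive : ∀ {g h} → g ≈ h → g ~ h
  ~-reflexive {g} g≈h = mem-resp (trans (sym (inverseˡ g)) (∙-congˡ g≈h)) ε∈

  ~-sym : ∀ {g h} → g ~ h → h ~ g
  ~-sym {g} {h} g~h =
    mem-resp (trans (⁻¹-anti-homo-∙ (g ⁻¹) h) (∙-congˡ (⁻¹-involutive g))) (⁻¹∈ g~h)

  ~-trans : ∀ {g h k} → g ~ h → h ~ k → g ~ k
  ~-trans {g} {h} {k} g~h h~k =
    mem-resp (trans (assoc (g ⁻¹) h (h ⁻¹ ∙ k)) (∙-congˡ (\\-leftDividesˡ h k))) (∙∈ g~h h~k)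

  ~-setoid : Setoid a a
  ~-setoid = record
    { Carrier       = Carrier
    ; _≈_           = _~_
    ; isEquivalence = record { refl = ~-reflexive ≈-refl ; sym = ~-sym ; trans = ~-trans }
    }

  -- right multiplication respects ~ because N is normal
  ~-congʳ : ∀ {g h} c → g ~ h → g ∙ c ~ h ∙ c
  ~-congʳ {g} {h} c g~h = mem-resp conj (normal (c ⁻¹) g~h)
    where
    conj : (c ⁻¹ ∙ (g ⁻¹ ∙ h)) ∙ c ⁻¹ ⁻¹ ≈ (g ∙ c) ⁻¹ ∙ (h ∙ c)
    conj = trans (∙-cong (sym (assoc _ _ _)) (⁻¹-involutive c))
             (trans (assoc _ _ _) (∙-congʳ (sym (⁻¹-anti-homo-∙ g c))))

  ~-congˡ : ∀ {g h} c → g ~ h → c ∙ g ~ c ∙ h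
  ~-congˡ {g} {h} c = mem-resp (sym cancel)
    where
    cancel : (c ∙ g) ⁻¹ ∙ (c ∙ h) ≈ g ⁻¹ ∙ h
    cancel = trans (∙-congʳ (⁻¹-anti-homo-∙ c g))
               (trans (assoc _ _ _) (∙-congˡ (\\-leftDividesʳ c h)))

  ~-cancelʳ : ∀ {g h} c → g ∙ c ~ h ∙ c → g ~ h
  ~-cancelʳ {g} {h} c gc~hc = mem-resp (∙-cong (⁻¹-cong (//-rightDividesʳ c g)) (//-rightDividesʳ c h))
                                         (~-congʳ (c ⁻¹) gc~hc)

  ~-cancelˡ : ∀ {g h} c → c ∙ g ~ c ∙ h → g ~ h
  ~-cancelˡ {g} {h} c cg~ch =
    ~-trans (~-reflexive (sym (\\-leftDividesʳ c g)))
      (~-trans (~-congˡ (c ⁻¹) cg~ch) (~-reflexive (\\-leftDividesʳ c h)))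

  ~-respˡ : ∀ {g g' h} → g ~ g' → (g ~ h ⇔ g' ~ h)
  ~-respˡ g~g' = mk⇔ (~-trans (~-sym g~g')) (~-trans g~g')

  ~-moveʳ : ∀ {g h} t → g ~ h ∙ t ⇔ g ∙ t ⁻¹ ~ h
  ~-moveʳ {g} {h} t = mk⇔
    (λ g~ht → ~-trans (~-congʳ (t ⁻¹) g~ht) (~-reflexive (//-rightDividesʳ t h)))
    (λ gt⁻¹~h → ~-cancelʳ (t ⁻¹) (~-trans gt⁻¹~h (~-reflexive (sym (//-rightDividesʳ t h)))))

module QuotientIsoProperties {a : Level} {G G' : Group a a}
         {H : NormalSubgroup G} {K : NormalSubgroup G'} (φ : QuotientIso H K) where
  open QuotientIso φ
  private
    module G  = Group G
    module G' = Group G'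
  open Congruence G' K
  open Congruence G H using () renaming (~-reflexive to ~H-reflexive)
  open SetoidReasoning ~-setoid

  f-ε : f G.ε ~ G'.ε
  f-ε = ~-sym (~-cancelˡ (f G.ε) (begin
    f G.ε G'.∙ G'.ε    ≈⟨ ~-reflexive (G'.identityʳ (f G.ε)) ⟩
    f G.ε              ≈⟨ f-wd (~H-reflexive (G.identityˡ G.ε)) ⟨
    f (G.ε G.∙ G.ε)    ≈⟨ f-hom G.ε G.ε ⟩
    f G.ε G'.∙ f G.ε   ∎))

  f-inverse : ∀ {u v} → u G.∙ v G.≈ G.ε → f u G'.∙ f v ~ G'.ε
  f-inverse {u} {v} uv≈ε = begin
    f u G'.∙ f v   ≈⟨ f-hom u v ⟨
    f (u G.∙ v)    ≈⟨ f-wd (~H-reflexive uv≈ε) ⟩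
    f G.ε          ≈⟨ f-ε ⟩
    G'.ε           ∎

module GroupPairProperties {a : Level} (F : GroupPair a) where
  open GroupPair F

  f : ∀ {x y} (e : E x y) → Car x → Car y
  f e = QuotientIso.f (φ e)

  ρ : ∀ {x y} (e : E x y) → κ e → Car y
  ρ e δ = f e (CosetEnumeration.rep (enum e) δ)

  module Coordinates {x y} (e : E x y) where
    open Group (G y) renaming (refl to ≈-refl)
    open Congruence (G y) (K e)
    open SetoidReasoning ~-setoid
    open GroupProperties (G y) using (\\-leftDividesˡ)
    private
      module φₑ = QuotientIso (φ e)
      module Enum = CosetEnumeration (enum e)

    K-cosets-cover : ∀ k → ∃[ δ ] ρ e δ ~ k
    K-cosets-cover k with φₑ.f-surj k
    ... | u , fu~k with Enum.covers u
    ... | δ , rep~u = δ , ~-trans (φₑ.f-wd rep~u) fu~k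

    R-coordinates : ∀ α {u v} → R e α (x , u) (y , v) ⇔ (f e u ∙ ρ e α ~ v)
    R-coordinates α {u} {v} = mk⇔ into outof
      where
      into : R e α (x , u) (y , v) → f e u ∙ ρ e α ~ v
      into (refl , refl , γ , rep~u , c , d , ργ~c , ρα~d , v≈cd) = begin
        f e u ∙ ρ e α   ≈⟨ ~-congʳ (ρ e α) (~-trans (~-sym (φₑ.f-wd rep~u)) ργ~c) ⟩
        c ∙ ρ e α       ≈⟨ ~-congˡ c ρα~d ⟩
        c ∙ d           ≈⟨ ~-reflexive v≈cd ⟨
        v               ∎
      outof : f e u ∙ ρ e α ~ v → R e α (x , u) (y , v)
      outof fuρ~v with Enum.covers u
      ... | γ , rep~u =
        refl , refl , γ , rep~u , c , c ⁻¹ ∙ v , ~-reflexive ≈-refl , ρα~c⁻¹v , sym (\\-leftDividesˡ c v)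
        where
        c : Carrier
        c = ρ e γ
        ρα~c⁻¹v : ρ e α ~ c ⁻¹ ∙ v
        ρα~c⁻¹v = ~-cancelˡ c (begin
          c ∙ ρ e α          ≈⟨ ~-congʳ (ρ e α) (φₑ.f-wd rep~u) ⟩
          f e u ∙ ρ e α      ≈⟨ fuρ~v ⟩
          v                  ≈⟨ ~-reflexive (\\-leftDividesˡ c v) ⟨
          c ∙ (c ⁻¹ ∙ v)     ∎)

    R-translate : ∀ δ t → Σ[ δ' ∈ κ e ] (∀ {u v} → R e δ (x , u) (y , v ∙ t) ⇔ R e δ' (x , u) (y , v))
    R-translate δ t with K-cosets-cover (ρ e δ ∙ t ⁻¹)
    ... | δ' , ρδ'~ρδt⁻¹ = δ' , λ {u} →
      ⇔.trans (R-coordinates δ)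
        (⇔.trans (~-moveʳ t) (⇔.trans (~-respˡ (same-coset u)) (⇔.sym (R-coordinates δ'))))
      where
      same-coset : ∀ u → f e u ∙ ρ e δ ∙ t ⁻¹ ~ f e u ∙ ρ e δ'
      same-coset u = begin
        f e u ∙ ρ e δ ∙ t ⁻¹     ≈⟨ ~-reflexive (assoc (f e u) (ρ e δ) (t ⁻¹)) ⟩
        f e u ∙ (ρ e δ ∙ t ⁻¹)   ≈⟨ ~-congˡ (f e u) ρδ'~ρδt⁻¹ ⟨
        f e u ∙ ρ e δ'           ∎

  translate : ∀ {z} → Car z → Rel → Rel
  translate {z} t S u (z' , w) = Σ[ r ∈ z' ≡ z ] S u (z , subst Car r w ∙ t)
    where open Group (G z)

  InA-resp : ∀ {S T} → S ≐ T → InA S → InA T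
  InA-resp S≐T (P , S≐⋃P) = P , λ u w → ⇔.trans (⇔.sym (S≐T u w)) (S≐⋃P u w)

  -- A is closed under translation: the translate of S is the union of those
  -- R_{xy,δ} that lie inside it, since each translated R_{xy,δ} is some R_{xy,δ'}
  InA-translate : ∀ {z} (t : Car z) {S} → InA S → InA (translate t S)
  InA-translate {z} t {S} (P , S≐⋃P) = P' , λ u w → mk⇔ (covered u w) (λ (_ , _ , _ , _ , R⊆ , r) → R⊆ r)
    where
    P' : ∀ x y (e : E x y) → κ e → Set a
    P' _ _ e δ = ∀ {u w} → R e δ u w → translate t S u w

    covered : ∀ u w → translate t S u w → Σ[ x ∈ I ] Σ[ y ∈ I ] Σ[ e ∈ E x y ] Σ[ δ ∈ κ e ]
                (P' x y e δ × R e δ u w)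
    covered (x , u) (_ , w) (refl , s) with to (S≐⋃P _ _) s
    ... | _ , _ , e , δ , Pδ , r@(refl , refl , _) with Coordinates.R-translate e δ t
    ... | δ' , δ⇔δ' = x , z , e , δ' , inside , to δ⇔δ' r
      where
      inside : P' x z e δ'
      inside r'@(refl , refl , _) = refl , from (S≐⋃P _ _) (x , z , e , δ , Pδ , from δ⇔δ' r')

  module Composite {x y z} (e₁ : E x y) (e₂ : E y z) where
    private
      module G₂ = Group (G y)
      module G₃ = Group (G z)
      module K₁ = Congruence (G y) (K e₁)
      module K₂ = Congruence (G z) (K e₂)
    open G₃ using (_∙_; _⁻¹; ε)
    open QuotientIsoProperties (φ e₂) using (f-inverse)

    Ladder : Car y → Car z → Car x → Car z → Set a
    Ladder a b u w = Σ[ v ∈ Car y ] ((f e₁ u G₂.∙ a) K₁.~ v × (f e₂ v ∙ b) K₂.~ w)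

    composite-coordinates : ∀ α β {u w} →
      (R e₁ α ⨾ R e₂ β) (x , u) (z , w) ⇔ Ladder (ρ e₁ α) (ρ e₂ β) u w
    composite-coordinates α β = mk⇔
      (λ { ((_ , v) , r₁@(_ , refl , _) , r₂) →
             v , to (Coordinates.R-coordinates e₁ α) r₁ , to (Coordinates.R-coordinates e₂ β) r₂ })
      (λ (v , h₁ , h₂) →
             (y , v) , from (Coordinates.R-coordinates e₁ α) h₁ , from (Coordinates.R-coordinates e₂ β) h₂)

    -- the translation turning the (a', b')-composite into the (a, b)-composite
    offset : Car y → Car y → Car z → Car z → Car z
    offset a a' b b' = b' ⁻¹ ∙ (f e₂ (a' G₂.⁻¹ G₂.∙ a) ∙ b)

    ladder-shift : ∀ a a' b b' {u w} → Ladder a' b' u w → Ladder a b u (w ∙ offset a a' b b')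
    ladder-shift a a' b b' {u} {w} (v , h₁ , h₂) = v G₂.∙ m , first , second
      where
      m : Car y
      m = a' G₂.⁻¹ G₂.∙ a
      first : (f e₁ u G₂.∙ a) K₁.~ (v G₂.∙ m)
      first = begin
        f e₁ u G₂.∙ a                ≈⟨ K₁.~-reflexive (Rearrangement.insert-inverse (G y) (f e₁ u) a' a) ⟩
        (f e₁ u G₂.∙ a') G₂.∙ m      ≈⟨ K₁.~-congʳ m h₁ ⟩
        v G₂.∙ m                     ∎
        where open SetoidReasoning K₁.~-setoid
      second : (f e₂ (v G₂.∙ m) ∙ b) K₂.~ (w ∙ offset a a' b b')
      second = begin
        f e₂ (v G₂.∙ m) ∙ b                              ≈⟨ K₂.~-congʳ b (QuotientIso.f-hom (φ e₂) v m) ⟩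
        (f e₂ v ∙ f e₂ m) ∙ b                            ≈⟨ K₂.~-reflexive (G₃.assoc _ _ _) ⟩
        f e₂ v ∙ (f e₂ m ∙ b)                            ≈⟨ K₂.~-reflexive (Rearrangement.insert-inverse (G z) _ b' _) ⟩
        (f e₂ v ∙ b') ∙ offset a a' b b'                 ≈⟨ K₂.~-congʳ (offset a a' b b') h₂ ⟩
        w ∙ offset a a' b b'                             ∎
        where open SetoidReasoning K₂.~-setoid

    offset-inverse : ∀ a a' b b' → (offset a a' b b' ∙ offset a' a b' b) K₂.~ ε
    offset-inverse a a' b b' = begin
      (b' ⁻¹ ∙ (f₂m ∙ b)) ∙ (b ⁻¹ ∙ (f₂m' ∙ b'))   ≈⟨ K₂.~-reflexive (Rearrangement.cancel-middle (G z) _ _ b _) ⟩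
      b' ⁻¹ ∙ (f₂m ∙ (f₂m' ∙ b'))                  ≈⟨ K₂.~-reflexive (G₃.∙-congˡ (G₃.sym (G₃.assoc _ _ _))) ⟩
      b' ⁻¹ ∙ ((f₂m ∙ f₂m') ∙ b')                  ≈⟨ K₂.~-congˡ (b' ⁻¹) (K₂.~-congʳ b' (f-inverse mm'≈ε)) ⟩
      b' ⁻¹ ∙ (ε ∙ b')                             ≈⟨ K₂.~-reflexive (G₃.trans (G₃.∙-congˡ (G₃.identityˡ b')) (G₃.inverseˡ b')) ⟩
      ε                                            ∎
      where
      open SetoidReasoning K₂.~-setoid
      f₂m f₂m' : Car z
      f₂m  = f e₂ (a' G₂.⁻¹ G₂.∙ a)
      f₂m' = f e₂ (a G₂.⁻¹ G₂.∙ a')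
      mm'≈ε : (a' G₂.⁻¹ G₂.∙ a) G₂.∙ (a G₂.⁻¹ G₂.∙ a') G₂.≈ G₂.ε
      mm'≈ε = G₂.trans (G₂.assoc _ _ _)
                (G₂.trans (G₂.∙-congˡ (GroupProperties.\\-leftDividesˡ (G y) a a')) (G₂.inverseˡ a'))

    ladder-unshift : ∀ a a' b b' {u w} → Ladder a b u (w ∙ offset a a' b b') → Ladder a' b' u w
    ladder-unshift a a' b b' {w = w} ℓ with ladder-shift a' a b' b ℓ
    ... | v , h₁ , h₂ = v , h₁ , K₂.~-trans h₂ back
      where
      back : ((w ∙ offset a a' b b') ∙ offset a' a b' b) K₂.~ w
      back = begin
        (w ∙ offset a a' b b') ∙ offset a' a b' b     ≈⟨ K₂.~-reflexive (G₃.assoc _ _ _) ⟩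
        w ∙ (offset a a' b b' ∙ offset a' a b' b)     ≈⟨ K₂.~-congˡ w (offset-inverse a a' b b') ⟩
        w ∙ ε                                         ≈⟨ K₂.~-reflexive (G₃.identityʳ w) ⟩
        w                                             ∎
        where open SetoidReasoning K₂.~-setoid

    composite-translate : ∀ α β α' β' →
      translate (offset (ρ e₁ α) (ρ e₁ α') (ρ e₂ β) (ρ e₂ β')) (R e₁ α ⨾ R e₂ β) ≐ (R e₁ α' ⨾ R e₂ β')
    composite-translate α β α' β' u w = mk⇔ (untranslated u w) (translated u w)
      where
      s : Car z
      s = offset (ρ e₁ α) (ρ e₁ α') (ρ e₂ β) (ρ e₂ β')
      untranslated : ∀ u w → translate s (R e₁ α ⨾ R e₂ β) u w → (R e₁ α' ⨾ R e₂ β') u w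
      untranslated _ _ (refl , c@(_ , (refl , _) , _)) =
        from (composite-coordinates α' β') (ladder-unshift _ _ _ _ (to (composite-coordinates α β) c))
      translated : ∀ u w → (R e₁ α' ⨾ R e₂ β') u w → translate s (R e₁ α ⨾ R e₂ β) u w
      translated _ _ c@(_ , (refl , _) , (_ , refl , _)) =
        refl , from (composite-coordinates α β) (ladder-shift _ _ _ _ (to (composite-coordinates α' β') c))

  composite-InA-transfer : ∀ {x y z} (e₁ : E x y) (e₂ : E y z) α β α' β' →
    InA (R e₁ α ⨾ R e₂ β) → InA (R e₁ α' ⨾ R e₂ β')
  composite-InA-transfer e₁ e₂ α β α' β' =
    InA-resp (composite-translate α β α' β') ∘ InA-translate _
    where open Composite e₁ e₂ using (composite-translate)

corollary4p7 : ∀ {a : Level} (F : GroupPair a) → GroupPair.InA F (GroupPair.idU F)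
    → ∀ {x y z} (e₁ : GroupPair.E F x y) (e₂ : GroupPair.E F y z)
    → (Σ[ α ∈ GroupPair.κ F e₁ ] Σ[ β ∈ GroupPair.κ F e₂ ]
         GroupPair.InA F (GroupPair._⨾_ F (GroupPair.R F e₁ α) (GroupPair.R F e₂ β)))
      ⇔ (∀ (α : GroupPair.κ F e₁) (β : GroupPair.κ F e₂) →
         GroupPair.InA F (GroupPair._⨾_ F (GroupPair.R F e₁ α) (GroupPair.R F e₂ β)))
corollary4p7 F _ e₁ e₂ = mk⇔
  (λ (α , β , inA) α' β' → composite-InA-transfer e₁ e₂ α β α' β' inA)
  (λ inA → 0₁ , 0₂ , inA 0₁ 0₂)
  where
  open GroupPairProperties F using (composite-InA-transfer)
  0₁ : GroupPair.κ F e₁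
  0₁ = CosetEnumeration.zero (GroupPair.enum F e₁)
  0₂ : GroupPair.κ F e₂
  0₂ = CosetEnumeration.zero (GroupPair.enum F e₂)
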